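{- Let $\mathbf{N}=\mathbf{N}(P,E)$ be a ported extensor, let $I\subseteq P$ and $V\subseteq P$ be sequences and $\bar V=P\setminus V$. Then \[\epsilon(\bar V V)\,\epsilon(PE)\,\mathbf{M}_E(\mathbf{N})[I_\iota V_\upsilon]=\epsilon(P)\sum_{A\subseteq E}\mathbf{N}[IA]\,\mathbf{N}[\bar V A]\,g_A\,r_{E\setminus A},\] where $g_A=\prod_{e\in A}g_e$ and $r_{E\setminus A}=\prod_{e\in E\setminus A}r_e$.
   Context: $K$ is a field, extended if necessary by parameters $g_e,r_e$ ($e\in E$). For a finite set $S$, $\mathcal{E}(KS)$ is the exterior algebra over $KS$ with basis $S$; for a sequence $A$ of distinct elements, $\mathbf{A}$ is the product of their images in order. Set symbols denote sequences in an arbitrary order; $AB$ is concatenation; $\bar X$ is the complement in the ground set in some order. An extensor with ground set $S$ is an element of $\mathcal{E}(KS)$ that is a scalar multiple of $\mathbf{1}$ or an exterior product of vectors; its Plücker coordinates are the alternating function $\mathbf{N}[A]$ (zero on sequences with repeats) with $\mathbf{N}=\sum_A\mathbf{N}[A]\mathbf{A}$. Contraction: $(\mathbf{N}/e)[B]=\mathbf{N}[Be]$; $\mathbf{N}/X=\mathbf{N}/x_k/\cdots/x_1$ for $X=x_1\cdots x_k$. A ground set orientation $\epsilon$ is an alternating function on finite sequences of ground set elements into $\{1,-1,0\}$, nonzero on sequences of distinct elements, $\epsilon(\emptyset)=1$; canonical dual $\mathbf{N}^\perp[X]=\mathbf{N}[\bar X]\epsilon(\bar X X)$. A ported extensor $\mathbf{N}(P,E)$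 is an extensor with ground set $P\sqcup E$. $P_\iota,P_\upsilon$ are disjoint copies of $P$ (disjoint from $E$); $Q_\iota,Q_\upsilon$ denote the copies of a sequence $Q$ over $P$. $\iota_g,\upsilon_r$ are the algebra homomorphisms $\mathcal{E}(K(P\sqcup E))\to\mathcal{E}(K(P_\iota\sqcup P_\upsilon\sqcup E))$ induced by $\mathbf{e}\mapsto g_e\mathbf{e},\ \mathbf{p}\mapsto\mathbf{p}_\iota$ and $\mathbf{e}\mapsto r_e\mathbf{e},\ \mathbf{p}\mapsto\mathbf{p}_\upsilon$. $\mathbf{M}(\mathbf{N})=\iota_g(\mathbf{N})\upsilon_r(\mathbf{N}^\perp)$ and, with $E$ a fixed sequence, $\mathbf{M}_E(\mathbf{N})=\mathbf{M}(\mathbf{N})/E$ (ground set $P_\iota\sqcup P_\upsilon$). -}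

module Defs where

open import Level using (Level; _⊔_; suc)
open import Algebra.Bundles using (CommutativeRing)
open import Data.Nat using (ℕ)
open import Data.Fin using (Fin)
open import Data.Bool using (if_then_else_)
open import Data.Sum using (_⊎_; inj₁; inj₂)
open import Data.Product using (_×_; _,_; ∃; Σ)
open import Data.List using (List; []; _∷_; _++_; map; foldr; filter; concatMap; length)
open import Data.List.Relation.Unary.Unique.Propositional using (Unique)
open import Relation.Nullary using (¬_; does; ¬?; yes; no)
open import Relation.Binary.PropositionalEquality using (_≡_; refl; cong)
import Data.Sum.Properties
import Data.Fin.Properties
import Data.List
open import Relation.Binary.Definitions using (DecidableEquality)
import Data.List.Membership.DecPropositional as DecMem

record Field (c ℓ : Level) : Set (suc (c ⊔ ℓ)) where
  field
    commRing : CommutativeRing c ℓ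
  open CommutativeRing commRing public
  field
    1≉0 : ¬ (1# ≈ 0#)
    inverse : ∀ x → ¬ (x ≈ 0#) → Σ Carrier λ y → x * y ≈ 1#

-- Elements of the ground set of M(N): P_ι ⊔ P_υ ⊔ E.
data Ground3 (p m : ℕ) : Set where
  pι : Fin p → Ground3 p m
  pυ : Fin p → Ground3 p m
  ee : Fin m → Ground3 p m

_≟G_ : ∀ {p m} → DecidableEquality (Ground3 p m)
pι a ≟G pι b with Data.Fin.Properties._≟_ a b
... | yes refl = yes refl
... | no ¬q = no λ { refl → ¬q refl }
pι _ ≟G pυ _ = no λ ()
pι _ ≟G ee _ = no λ ()
pυ _ ≟G pι _ = no λ ()
pυ a ≟G pυ b with Data.Fin.Properties._≟_ a b
... | yes refl = yes refl
... | no ¬q = no λ { refl → ¬q refl }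
pυ _ ≟G ee _ = no λ ()
ee _ ≟G pι _ = no λ ()
ee _ ≟G pυ _ = no λ ()
ee a ≟G ee b with Data.Fin.Properties._≟_ a b
... | yes refl = yes refl
... | no ¬q = no λ { refl → ¬q refl }

PE : ℕ → ℕ → Set
PE p m = Fin p ⊎ Fin m

_≟PE_ : ∀ {p m} → DecidableEquality (PE p m)
_≟PE_ = Data.Sum.Properties.≡-dec Data.Fin.Properties._≟_ Data.Fin.Properties._≟_

enumPE : ∀ p m → List (PE p m)
enumPE p m = map inj₁ (Data.List.allFin p) ++ map inj₂ (Data.List.allFin m)

complP : ∀ {p} → List (Fin p) → List (Fin p)
complP {p} X = filter (λ x → ¬? (x ∈? X)) (Data.List.allFin p)
  where open DecMem Data.Fin.Properties._≟_ using (_∈?_)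

complPE : ∀ {p m} → List (PE p m) → List (PE p m)
complPE {p} {m} X = filter (λ x → ¬? (x ∈? X)) (enumPE p m)
  where open DecMem _≟PE_ using (_∈?_)

module Ext {c ℓ} (F : Field c ℓ) where
  open Field F public

  -- Elements of the exterior algebra E(KS), represented by their
  -- coordinate function on finite sequences of ground-set elements
  -- (N = Σ_A N[A] 𝐀).
  MV : Set → Set c
  MV S = List S → Carrier

  _≋_ : ∀ {S} → MV S → MV S → Set ℓ
  x ≋ y = ∀ A → x A ≈ y A

  Σl : List Carrier → Carrier
  Σl = foldr _+_ 0#

  Πl : List Carrier → Carrier
  Πl = foldr _*_ 1#

  scalar : ∀ {S} → Carrier → MV S
  scalar a [] = a
  scalar a (_ ∷ _) = 0#

  vec : ∀ {S} → (S → Carrier) → MV S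
  vec v (s ∷ []) = v s
  vec v _ = 0#

  _·_ : ∀ {S} → Carrier → MV S → MV S
  (a · x) A = a * x A

  _⊕_ : ∀ {S} → MV S → MV S → MV S
  (x ⊕ y) A = x A + y A

  sumMV : ∀ {S} → List (MV S) → MV S
  sumMV = foldr _⊕_ (scalar 0#)

  signLen : ∀ {S : Set} → List S → Carrier → Carrier
  signLen [] a = a
  signLen (_ ∷ L) a = - signLen L a

  -- all ways of splitting a sequence C into a complementary pair of
  -- subsequences (L , R), together with the sign of the shuffle C ↦ L R
  splits : ∀ {S : Set} → List S → List (List S × List S × Carrier)
  splits [] = ([] , [] , 1#) ∷ []
  splits (c ∷ C) = concatMap
    (λ { (L , R , s) → (c ∷ L , R , s) ∷ (L , c ∷ R , signLen L s) ∷ [] })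
    (splits C)

  -- exterior product (shuffle formula for coordinates)
  _∧_ : ∀ {S} → MV S → MV S → MV S
  (x ∧ y) C = Σl (map (λ { (L , R , s) → s * (x L * y R) }) (splits C))

  ⋀ : ∀ {S} → List (MV S) → MV S
  ⋀ = foldr _∧_ (scalar 1#)

  IsExtensor : ∀ {S : Set} → MV S → Set (c ⊔ ℓ)
  IsExtensor {S} N =
    (Σ Carrier λ a → N ≋ scalar a)
    ⊎ (Σ (List (S → Carrier)) λ vs → N ≋ ⋀ (map vec vs))

  subsetsC : ∀ {S : Set} → List S → List (List S × List S)
  subsetsC [] = ([] , []) ∷ []
  subsetsC (x ∷ xs) = concatMap
    (λ { (A , B) → (x ∷ A , B) ∷ (A , x ∷ B) ∷ [] }) (subsetsC xs)

  -- The algebra homomorphism E(KS) → E(KT) induced by a linear map on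
  -- generators f : S → (vectors over T); S enumerated by `enum`
  -- (so the sublists of enum index a basis).
  induced : ∀ {S T} → List S → (S → MV T) → MV S → MV T
  induced enum f N =
    sumMV (map (λ { (A , _) → N A · ⋀ (map f A) }) (subsetsC enum))

  unit : ∀ {T} → DecidableEquality T → T → MV T
  unit _≟T_ t = vec (λ s → if does (s ≟T t) then 1# else 0#)

  _/₁_ : ∀ {S} → MV S → S → MV S
  (N /₁ e) B = N (B ++ (e ∷ []))

  _/_ : ∀ {S} → MV S → List S → MV S
  N / [] = N
  N / (x ∷ X) = (N / X) /₁ x

  record IsGroundOrientation {S : Set} (ε : List S → Carrier) : Set (c ⊔ ℓ) where
    field
      ε-nil : ε [] ≈ 1#
      ε-swap : ∀ xs a b ys → ε (xs ++ a ∷ b ∷ ys) ≈ - ε (xs ++ b ∷ a ∷ ys)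
      ε-repeat : ∀ xs → ¬ Unique xs → ε xs ≈ 0#
      ε-distinct : ∀ xs → Unique xs → (ε xs ≈ 1#) ⊎ (ε xs ≈ - 1#)


  module Ported {p m : ℕ} (ε : List (PE p m) → Carrier)
                (g r : Fin m → Carrier) where

    dual : MV (PE p m) → MV (PE p m)
    dual N X = N (complPE X) * ε (complPE X ++ X)

    ι-gen : PE p m → MV (Ground3 p m)
    ι-gen (inj₁ q) = unit _≟G_ (pι q)
    ι-gen (inj₂ e) = g e · unit _≟G_ (ee e)

    υ-gen : PE p m → MV (Ground3 p m)
    υ-gen (inj₁ q) = unit _≟G_ (pυ q)
    υ-gen (inj₂ e) = r e · unit _≟G_ (ee e)

    ιg : MV (PE p m) → MV (Ground3 p m)
    ιg = induced (enumPE p m) ι-gen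

    υr : MV (PE p m) → MV (Ground3 p m)
    υr = induced (enumPE p m) υ-gen

    M : MV (PE p m) → MV (Ground3 p m)
    M N = ιg N ∧ υr (dual N)

    M_ : List (Fin m) → MV (PE p m) → MV (Ground3 p m)
    M_ Es N = M N / map ee Es

{-# OPTIONS --safe #-}
module Submission where

open import Defs
open import Data.Nat as ℕ using (ℕ; zero; suc)
import Data.Nat.Properties as ℕₚ
open import Data.Fin using (Fin)
import Data.Fin
open import Data.Bool using (if_then_else_)
open import Data.Empty using (⊥; ⊥-elim)
open import Data.Product using (_×_; _,_; proj₁; proj₂)
open import Data.Sum using (_⊎_; inj₁; inj₂)
open import Data.Sum.Properties using (inj₁-injective; inj₂-injective)
open import Data.List using (List; []; _∷_; _++_; map; filter; concatMap; length; allFin)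
import Data.List.Properties as Listₚ
open import Data.List.Relation.Unary.All as All using (All; []; _∷_)
import Data.List.Relation.Unary.All.Properties as AllP
open import Data.List.Relation.Unary.AllPairs using ([]; _∷_)
open import Data.List.Relation.Unary.Any as Any using (here; there)
open import Data.List.Relation.Unary.Unique.Propositional using (Unique)
import Data.List.Relation.Unary.Unique.Propositional.Properties as Uniqueₚ
open import Data.List.Relation.Binary.Permutation.Propositional as ↭ using (_↭_; ↭⇒↭ₛ)
import Data.List.Relation.Binary.Permutation.Propositional.Properties as ↭ₚ
import Data.List.Relation.Binary.Permutation.Setoid.Properties as ↭ₛₚ
open import Data.List.Relation.Binary.BagAndSetEquality using (∼bag⇒↭)
open import Data.List.Membership.Propositional using (_∈_; _∉_)
open import Data.List.Membership.Propositional.Properties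
  using (∈-∃++; ∈-++⁺ˡ; ∈-++⁺ʳ; ∈-++⁻; ∈-map⁺; ∈-map⁻; ∈-allFin; ∈-filter⁺; ∈-filter⁻)
open import Data.List.Membership.Propositional.Properties.WithK using (unique∧set⇒bag)
import Data.List.Membership.DecPropositional as DecMembership
import Algebra.Solver.Ring.NaturalCoefficients.Default as NaturalCoefficients
open import Function using (_∘_; mk⇔)
open import Relation.Binary.Definitions using (DecidableEquality)
open import Relation.Binary.PropositionalEquality as ≡ using (_≡_; _≢_)
open import Relation.Nullary using (¬?; yes; no; does)

-- M_E(N)[I_ι V_υ] is the coordinate M(N)[I_ι V_υ E] of the exterior product x ∧ y, where
-- x = ι_g(N) and y = υ_r(N^⊥).  As x does not involve P_υ and y does not involve P_ι, the
-- shuffle expansion of this coordinate hands I_ι to x and V_υ to y, the latter at the cost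
-- (-1)^{|V||A|} of moving V_υ past the part A of E taken by x.  What remains is a sum over
-- the splittings E = A ⊔ B with shuffle signs σ_{A,B}.  Being images of homomorphisms,
-- x[I_ι A] = g_A N[IA] and y[V_υ B] = r_B N^⊥[VB] = r_B N[V̄A] ε(V̄AVB), because V̄A is the
-- complement of VB.  Reordering, ε(V̄AVB) = (-1)^{|A||V|} σ_{A,B} ε(V̄VE), and
-- ε(V̄V) ε(V̄VE) = ε(P) ε(PE) as V̄V is a permutation of P; every sign then occurs squared.

Unique-resp-↭ : ∀ {S : Set} {xs ys : List S} → xs ↭ ys → Unique xs → Unique ys
Unique-resp-↭ {S} p = ↭ₛₚ.Unique-resp-↭ (≡.setoid S) (↭⇒↭ₛ p)

Unique-++⁻ : ∀ {S : Set} (xs : List S) {ys} → Unique (xs ++ ys) → Unique xs × Unique ys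
Unique-++⁻ [] u = [] , u
Unique-++⁻ (x ∷ xs) (x∉ ∷ u) = (AllP.++⁻ˡ xs x∉ ∷ proj₁ (Unique-++⁻ xs u)) , proj₂ (Unique-++⁻ xs u)

Unique-++⇒disjoint : ∀ {S : Set} (xs : List S) {ys z} → Unique (xs ++ ys) → z ∈ xs → z ∉ ys
Unique-++⇒disjoint (x ∷ xs) (x∉ ∷ u) (here ≡.refl) z∈ys = All.lookup x∉ (∈-++⁺ʳ xs z∈ys) ≡.refl
Unique-++⇒disjoint (x ∷ xs) (_ ∷ u) (there z∈xs) = Unique-++⇒disjoint xs u z∈xs

Unique-middle : ∀ {S : Set} (L : List S) {e R} → Unique (L ++ e ∷ R) → e ∉ L ++ R × Unique (L ++ R)
Unique-middle L {e} {R} u with Unique-resp-↭ (↭ₚ.shift e L R) u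
... | e∉ ∷ uLR = Uniqueₚ.Unique[x∷xs]⇒x∉xs (e∉ ∷ uLR) , uLR

∈-middle⁻ : ∀ {S : Set} (L : List S) {e R z} → z ∈ L ++ e ∷ R → z ≢ e → z ∈ L ++ R
∈-middle⁻ L {e} {R} z∈ z≢e = Any.tail z≢e (↭ₚ.∈-resp-↭ (↭ₚ.shift e L R) z∈)

∈-middle⁺ : ∀ {S : Set} (L : List S) {e R z} → z ∈ L ++ R → z ∈ L ++ e ∷ R
∈-middle⁺ L {e} {R} z∈ = ↭ₚ.∈-resp-↭ (↭.↭-sym (↭ₚ.shift e L R)) (there z∈)

-- complP and complPE are, definitionally, complementIn (allFin p) and complementIn (enumPE p m).
module Complement {S : Set} (_≟_ : DecidableEquality S) where
  open DecMembership _≟_ using (_∈?_)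

  complementIn : List S → List S → List S
  complementIn enum X = filter (λ x → ¬? (x ∈? X)) enum

  complementIn-resp-↭ : ∀ enum {X Y} → X ↭ Y → complementIn enum X ≡ complementIn enum Y
  complementIn-resp-↭ enum X↭Y = Listₚ.filter-≐ (λ x → ¬? (x ∈? _)) (λ x → ¬? (x ∈? _))
    ((λ x∉X x∈Y → x∉X (↭ₚ.∈-resp-↭ (↭.↭-sym X↭Y) x∈Y)) , (λ x∉Y x∈X → x∉Y (↭ₚ.∈-resp-↭ X↭Y x∈X)))
    enum

  complementIn-unique : ∀ {enum} X → Unique enum → Unique (complementIn enum X)
  complementIn-unique X = Uniqueₚ.filter⁺ (λ x → ¬? (x ∈? X))

  ++-complementIn-↭ : ∀ {enum X Y} → Unique enum → X ++ Y ↭ enum → complementIn enum X ↭ Y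
  ++-complementIn-↭ {enum} {X} {Y} uenum XY↭enum =
    ∼bag⇒↭ (unique∧set⇒bag (complementIn-unique X uenum) (proj₂ (Unique-++⁻ X uXY)) (mk⇔ to from))
    where
    uXY = Unique-resp-↭ (↭.↭-sym XY↭enum) uenum
    to : ∀ {z} → z ∈ complementIn enum X → z ∈ Y
    to z∈ with ∈-filter⁻ (λ x → ¬? (x ∈? X)) {xs = enum} z∈
    ... | z∈enum , z∉X with ∈-++⁻ X (↭ₚ.∈-resp-↭ (↭.↭-sym XY↭enum) z∈enum)
    ... | inj₁ z∈X = ⊥-elim (z∉X z∈X)
    ... | inj₂ z∈Y = z∈Y
    from : ∀ {z} → z ∈ Y → z ∈ complementIn enum X
    from z∈Y = ∈-filter⁺ (λ x → ¬? (x ∈? X)) (↭ₚ.∈-resp-↭ XY↭enum (∈-++⁺ʳ X z∈Y))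
                 (λ z∈X → Unique-++⇒disjoint X uXY z∈X z∈Y)

  complementIn-++-↭ : ∀ {enum X} → Unique enum → Unique X → (∀ z → z ∈ enum) → X ++ complementIn enum X ↭ enum
  complementIn-++-↭ {enum} {X} uenum uX ∈enum =
    ∼bag⇒↭ (unique∧set⇒bag uXX̄ uenum (λ {z} → mk⇔ (λ _ → ∈enum z) from))
    where
    uXX̄ : Unique (X ++ complementIn enum X)
    uXX̄ = Uniqueₚ.++⁺ uX (complementIn-unique X uenum)
      (λ (z∈X , z∈X̄) → proj₂ (∈-filter⁻ (λ x → ¬? (x ∈? X)) {xs = enum} z∈X̄) z∈X)
    from : ∀ {z} → z ∈ enum → z ∈ X ++ complementIn enum X
    from {z} z∈enum with z ∈? X
    ... | yes z∈X = ∈-++⁺ˡ z∈X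
    ... | no z∉X = ∈-++⁺ʳ X (∈-filter⁺ (λ x → ¬? (x ∈? X)) z∈enum z∉X)

Unique-inj₁-++-inj₂ : ∀ {p m} {A : List (Fin p)} {B : List (Fin m)} → Unique A → Unique B →
                      Unique (map {B = PE p m} inj₁ A ++ map inj₂ B)
Unique-inj₁-++-inj₂ uA uB =
  Uniqueₚ.++⁺ (Uniqueₚ.map⁺ inj₁-injective uA) (Uniqueₚ.map⁺ inj₂-injective uB) disjoint
  where
  disjoint : ∀ {z} → z ∈ map inj₁ _ × z ∈ map inj₂ _ → ⊥
  disjoint (z∈A , z∈B) with ∈-map⁻ inj₁ z∈A | ∈-map⁻ inj₂ z∈B
  ... | _ , _ , ≡.refl | _ , _ , ()

enumPE-unique : ∀ p m → Unique (enumPE p m)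
enumPE-unique p m = Unique-inj₁-++-inj₂ (Uniqueₚ.allFin⁺ p) (Uniqueₚ.allFin⁺ m)

∈-enumPE : ∀ {p m} (z : PE p m) → z ∈ enumPE p m
∈-enumPE {p} (inj₁ q) = ∈-++⁺ˡ (∈-map⁺ inj₁ (∈-allFin q))
∈-enumPE {p} (inj₂ e) = ∈-++⁺ʳ (map inj₁ (allFin p)) (∈-map⁺ inj₂ (∈-allFin e))

complPE-partition : ∀ {p m} {V V̄ : List (Fin p)} {A B : List (Fin m)} → V ++ V̄ ↭ allFin p → B ++ A ↭ allFin m →
                    complPE (map inj₁ V ++ map inj₂ B) ↭ map inj₁ V̄ ++ map inj₂ A
complPE-partition {p} {m} {V} {V̄} {A} {B} VV̄↭ BA↭ = Complement.++-complementIn-↭ _≟PE_ (enumPE-unique p m) partition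
  where
  open ↭.PermutationReasoning
  partition : (map inj₁ V ++ map inj₂ B) ++ (map inj₁ V̄ ++ map inj₂ A) ↭ enumPE p m
  partition = begin
    (map inj₁ V ++ map inj₂ B) ++ map inj₁ V̄ ++ map inj₂ A   ≡⟨ Listₚ.++-assoc (map inj₁ V) (map inj₂ B) _ ⟩
    map inj₁ V ++ map inj₂ B ++ map inj₁ V̄ ++ map inj₂ A
      ↭⟨ ↭ₚ.++⁺ˡ (map inj₁ V) (↭ₚ.shifts (map inj₂ B) (map inj₁ V̄)) ⟩
    map inj₁ V ++ map inj₁ V̄ ++ map inj₂ B ++ map inj₂ A     ≡⟨ Listₚ.++-assoc (map inj₁ V) (map inj₁ V̄) _ ⟨
    (map inj₁ V ++ map inj₁ V̄) ++ map inj₂ B ++ map inj₂ A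
      ≡⟨ ≡.cong₂ _++_ (Listₚ.map-++ inj₁ V V̄) (Listₚ.map-++ inj₂ B A) ⟨
    map inj₁ (V ++ V̄) ++ map inj₂ (B ++ A)                   ↭⟨ ↭ₚ.++⁺ (↭ₚ.map⁺ inj₁ VV̄↭) (↭ₚ.map⁺ inj₂ BA↭) ⟩
    enumPE p m                                               ∎

module Exterior {c ℓ} (F : Field c ℓ) where
  open Ext F
  open import Algebra.Properties.Ring ring using (-‿distribˡ-*; -‿distribʳ-*; -1*x≈-x)
  open import Algebra.Properties.AbelianGroup +-abelianGroup
    using (⁻¹-∙-comm; ⁻¹-involutive) renaming (ε⁻¹≈ε to -0#≈0#)
  open NaturalCoefficients commutativeSemiring using (solve; _:=_; _:+_; _:*_)
  open import Relation.Binary.Reasoning.Setoid setoid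

  -x*-y≈x*y : ∀ x y → - x * - y ≈ x * y
  -x*-y≈x*y x y = begin
    - x * - y     ≈⟨ -‿distribˡ-* x (- y) ⟨
    - (x * - y)   ≈⟨ -‿cong (-‿distribʳ-* x y) ⟨
    - - (x * y)   ≈⟨ ⁻¹-involutive (x * y) ⟩
    x * y         ∎

  0#-0#≈0# : 0# - 0# ≈ 0#
  0#-0#≈0# = trans (+-congˡ -0#≈0#) (+-identityʳ 0#)

  sgn : ℕ → Carrier
  sgn zero = 1#
  sgn (suc k) = - sgn k

  sgn-+ : ∀ m n → sgn (m ℕ.+ n) ≈ sgn m * sgn n
  sgn-+ zero n = sym (*-identityˡ _)
  sgn-+ (suc m) n = trans (-‿cong (sgn-+ m n)) (-‿distribˡ-* _ _)

  sgn-sq : ∀ k → sgn k * sgn k ≈ 1#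
  sgn-sq zero = *-identityˡ _
  sgn-sq (suc k) = trans (-x*-y≈x*y (sgn k) (sgn k)) (sgn-sq k)

  sgn-flip : ∀ k {a b} → a ≈ sgn k * b → b ≈ sgn k * a
  sgn-flip k {a} {b} a≈ = begin
    b                    ≈⟨ *-identityˡ b ⟨
    1# * b               ≈⟨ *-congʳ (sgn-sq k) ⟨
    sgn k * sgn k * b    ≈⟨ *-assoc _ _ _ ⟩
    sgn k * (sgn k * b)  ≈⟨ *-congˡ a≈ ⟨
    sgn k * a            ∎

  signLen≈sgn : ∀ {S : Set} (L : List S) a → signLen L a ≈ sgn (length L) * a
  signLen≈sgn [] a = sym (*-identityˡ a)
  signLen≈sgn (_ ∷ L) a = trans (-‿cong (signLen≈sgn L a)) (-‿distribˡ-* _ _)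

  signLen-zero : ∀ {S : Set} (L : List S) → signLen L 0# ≈ 0#
  signLen-zero L = trans (signLen≈sgn L 0#) (zeroʳ _)

  signLen-cong : ∀ {S : Set} (L : List S) {a b} → a ≈ b → signLen L a ≈ signLen L b
  signLen-cong [] a≈b = a≈b
  signLen-cong (_ ∷ L) a≈b = -‿cong (signLen-cong L a≈b)

  Σl-cong : ∀ {a} {A : Set a} {f g : A → Carrier} (l : List A) → (∀ t → f t ≈ g t) → Σl (map f l) ≈ Σl (map g l)
  Σl-cong [] f≈g = refl
  Σl-cong (t ∷ l) f≈g = +-cong (f≈g t) (Σl-cong l f≈g)

  Σl-cong-All : ∀ {a} {A : Set a} {f g : A → Carrier} {l : List A} → All (λ t → f t ≈ g t) l →
                Σl (map f l) ≈ Σl (map g l)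
  Σl-cong-All [] = refl
  Σl-cong-All (ft≈gt ∷ f≈g) = +-cong ft≈gt (Σl-cong-All f≈g)

  *-distribˡ-Σl : ∀ {a} {A : Set a} x (f : A → Carrier) (l : List A) → x * Σl (map f l) ≈ Σl (map (λ t → x * f t) l)
  *-distribˡ-Σl x f [] = zeroʳ x
  *-distribˡ-Σl x f (t ∷ l) = trans (distribˡ x _ _) (+-congˡ (*-distribˡ-Σl x f l))

  Σl-zero : ∀ {a} {A : Set a} {f : A → Carrier} (l : List A) → (∀ t → f t ≈ 0#) → Σl (map f l) ≈ 0#
  Σl-zero [] f≈0 = refl
  Σl-zero (t ∷ l) f≈0 = trans (+-cong (f≈0 t) (Σl-zero l f≈0)) (+-identityˡ _)

  Σl-concatMap-pair : ∀ {a b} {A : Set a} {B : Set b} (f : B → Carrier) (h₁ h₂ : A → B) (l : List A) →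
    Σl (map f (concatMap (λ t → h₁ t ∷ h₂ t ∷ []) l)) ≈ Σl (map (f ∘ h₁) l) + Σl (map (f ∘ h₂) l)
  Σl-concatMap-pair f h₁ h₂ [] = sym (+-identityˡ _)
  Σl-concatMap-pair f h₁ h₂ (t ∷ l) = trans (sym (+-assoc _ _ _)) (trans (+-congˡ (Σl-concatMap-pair f h₁ h₂ l))
    (solve 4 (λ a b c d → ((a :+ b) :+ (c :+ d)) := ((a :+ c) :+ (b :+ d))) refl _ _ _ _))

  Σl-map : ∀ {a b} {A : Set a} {B : Set b} (f : B → Carrier) (h : A → B) (l : List A) →
           Σl (map f (map h l)) ≡ Σl (map (f ∘ h) l)
  Σl-map f h l = ≡.cong Σl (≡.sym (Listₚ.map-∘ l))

  -- Exterior products and alternating functions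

  _⌟_ : ∀ {S : Set} → S → MV S → MV S
  (s ⌟ x) L = x (s ∷ L)

  involute : ∀ {S : Set} → MV S → MV S
  involute x L = signLen L (x L)

  -- The graded Leibniz rule for the contraction s ⌟_, which is the recursion defining splits.
  ∧-∷ : ∀ {S : Set} (x y : MV S) s C → (x ∧ y) (s ∷ C) ≈ ((s ⌟ x) ∧ y) C + (involute x ∧ (s ⌟ y)) C
  ∧-∷ x y s C = begin
    (x ∧ y) (s ∷ C)                                      ≈⟨ Σl-concatMap-pair term left right (splits C) ⟩
    Σl (map (term ∘ left) (splits C)) + Σl (map (term ∘ right) (splits C))
      ≈⟨ +-congˡ (Σl-cong (splits C) (λ (L , R , σ) → signLen-move L σ (x L) (y (s ∷ R)))) ⟩
    ((s ⌟ x) ∧ y) C + (involute x ∧ (s ⌟ y)) C            ∎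
    where
    term : _ → Carrier
    term (L , R , σ) = σ * (x L * y R)
    left right : _ → _
    left (L , R , σ) = (s ∷ L , R , σ)
    right (L , R , σ) = (L , s ∷ R , signLen L σ)
    signLen-move : ∀ {S : Set} (L : List S) σ a b → signLen L σ * (a * b) ≈ σ * (signLen L a * b)
    signLen-move L σ a b = begin
      signLen L σ * (a * b)                ≈⟨ *-congʳ (signLen≈sgn L σ) ⟩
      sgn (length L) * σ * (a * b)
        ≈⟨ solve 4 (λ k σ a b → ((k :* σ) :* (a :* b)) := (σ :* ((k :* a) :* b))) refl (sgn (length L)) σ a b ⟩
      σ * (sgn (length L) * a * b)         ≈⟨ *-congˡ (*-congʳ (signLen≈sgn L a)) ⟨
      σ * (signLen L a * b)                ∎

  ∧-cong : ∀ {S : Set} {x x′ y y′ : MV S} → x ≋ x′ → y ≋ y′ → (x ∧ y) ≋ (x′ ∧ y′)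
  ∧-cong x≋x′ y≋y′ C = Σl-cong (splits C) (λ (L , R , σ) → *-congˡ (*-cong (x≋x′ L) (y≋y′ R)))

  ·-∧ : ∀ {S : Set} a (x y : MV S) → ((a · x) ∧ y) ≋ (a · (x ∧ y))
  ·-∧ a x y C = trans (Σl-cong (splits C) (λ (L , R , σ) →
      solve 4 (λ σ a x y → (σ :* ((a :* x) :* y)) := (a :* (σ :* (x :* y)))) refl σ a (x L) (y R)))
    (sym (*-distribˡ-Σl a _ (splits C)))

  ∧-· : ∀ {S : Set} a (x y : MV S) → (x ∧ (a · y)) ≋ (a · (x ∧ y))
  ∧-· a x y C = trans (Σl-cong (splits C) (λ (L , R , σ) →
      solve 4 (λ σ a x y → (σ :* (x :* (a :* y))) := (a :* (σ :* (x :* y)))) refl σ a (x L) (y R)))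
    (sym (*-distribˡ-Σl a _ (splits C)))

  ∧-zeroˡ : ∀ {S : Set} {x : MV S} (y : MV S) → (∀ L → x L ≈ 0#) → ∀ C → (x ∧ y) C ≈ 0#
  ∧-zeroˡ y x≈0 C =
    Σl-zero (splits C) (λ (L , R , σ) → trans (*-congˡ (trans (*-congʳ (x≈0 L)) (zeroˡ _))) (zeroʳ σ))

  ∧-zeroʳ : ∀ {S : Set} (x : MV S) {y : MV S} → (∀ L → y L ≈ 0#) → ∀ C → (x ∧ y) C ≈ 0#
  ∧-zeroʳ x y≈0 C =
    Σl-zero (splits C) (λ (L , R , σ) → trans (*-congˡ (trans (*-congˡ (y≈0 R)) (zeroʳ _))) (zeroʳ σ))

  scalar-∧ : ∀ {S : Set} a (y : MV S) → (scalar a ∧ y) ≋ (a · y)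
  scalar-∧ a y [] = trans (+-identityʳ _) (*-identityˡ _)
  scalar-∧ a y (s ∷ C) = begin
    (scalar a ∧ y) (s ∷ C)                                  ≈⟨ ∧-∷ (scalar a) y s C ⟩
    ((s ⌟ scalar a) ∧ y) C + (involute (scalar a) ∧ (s ⌟ y)) C
      ≈⟨ +-cong (trans (∧-zeroˡ y (λ { [] → refl ; (_ ∷ _) → refl }) C) (sym (zeroˡ _)))
                (trans (∧-cong involute-scalar (λ _ → refl) C) (scalar-∧ a (s ⌟ y) C)) ⟩
    0# * y C + a * y (s ∷ C)                                 ≈⟨ trans (+-congʳ (zeroˡ _)) (+-identityˡ _) ⟩
    a * y (s ∷ C)                                            ∎
    where
    involute-scalar : involute (scalar a) ≋ scalar a
    involute-scalar [] = refl
    involute-scalar (t ∷ L) = signLen-zero (t ∷ L)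

  vec-∧-∷ : ∀ {S : Set} (v : S → Carrier) (y : MV S) s C → (vec v ∧ y) (s ∷ C) ≈ v s * y C - (vec v ∧ (s ⌟ y)) C
  vec-∧-∷ v y s C = begin
    (vec v ∧ y) (s ∷ C)                                    ≈⟨ ∧-∷ (vec v) y s C ⟩
    ((s ⌟ vec v) ∧ y) C + (involute (vec v) ∧ (s ⌟ y)) C
      ≈⟨ +-cong (trans (∧-cong {y = y} (λ { [] → refl ; (_ ∷ _) → refl }) (λ _ → refl) C) (scalar-∧ (v s) y C))
                (trans (∧-cong involute-vec (λ _ → refl) C) (·-∧ (- 1#) (vec v) (s ⌟ y) C)) ⟩
    v s * y C + - 1# * (vec v ∧ (s ⌟ y)) C                  ≈⟨ +-congˡ (-1*x≈-x _) ⟩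
    v s * y C - (vec v ∧ (s ⌟ y)) C                         ∎
    where
    involute-vec : involute (vec v) ≋ ((- 1#) · vec v)
    involute-vec [] = sym (zeroʳ _)
    involute-vec (t ∷ []) = sym (-1*x≈-x _)
    involute-vec (t ∷ u ∷ L) = trans (signLen-zero (t ∷ u ∷ L)) (sym (zeroʳ _))

  ·-vec : ∀ {S : Set} a (v : S → Carrier) → (a · vec v) ≋ vec (λ s → a * v s)
  ·-vec a v [] = zeroʳ a
  ·-vec a v (_ ∷ []) = refl
  ·-vec a v (_ ∷ _ ∷ _) = zeroʳ a

  /-eval : ∀ {S : Set} (M : MV S) X B → (M / X) B ≡ M (B ++ X)
  /-eval M [] B = ≡.cong M (≡.sym (Listₚ.++-identityʳ B))
  /-eval M (x ∷ X) B = ≡.trans (/-eval M X (B ++ x ∷ [])) (≡.cong M (Listₚ.++-assoc B (x ∷ []) X))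

  Alternating : ∀ {S : Set} → MV S → Set ℓ
  Alternating f = ∀ xs a b ys → f (xs ++ a ∷ b ∷ ys) ≈ - f (xs ++ b ∷ a ∷ ys)

  Alternating-≋ : ∀ {S : Set} {f g : MV S} → f ≋ g → Alternating g → Alternating f
  Alternating-≋ f≋g alt xs a b ys = trans (f≋g _) (trans (alt xs a b ys) (-‿cong (sym (f≋g _))))

  Alternating-prefix : ∀ {S : Set} {f : MV S} pre → Alternating f → Alternating (λ X → f (pre ++ X))
  Alternating-prefix {f = f} pre alt xs a b ys = begin
    f (pre ++ xs ++ a ∷ b ∷ ys)      ≡⟨ ≡.cong f (Listₚ.++-assoc pre xs _) ⟨
    f ((pre ++ xs) ++ a ∷ b ∷ ys)    ≈⟨ alt (pre ++ xs) a b ys ⟩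
    - f ((pre ++ xs) ++ b ∷ a ∷ ys)  ≡⟨ ≡.cong (-_ ∘ f) (Listₚ.++-assoc pre xs _) ⟩
    - f (pre ++ xs ++ b ∷ a ∷ ys)    ∎

  Alternating-⌟ : ∀ {S : Set} {f : MV S} s → Alternating f → Alternating (s ⌟ f)
  Alternating-⌟ {f = f} s = Alternating-prefix {f = f} (s ∷ [])

  Alternating-suffix : ∀ {S : Set} {f : MV S} post → Alternating f → Alternating (λ X → f (X ++ post))
  Alternating-suffix {f = f} post alt xs a b ys = begin
    f ((xs ++ a ∷ b ∷ ys) ++ post)   ≡⟨ ≡.cong f (Listₚ.++-assoc xs _ post) ⟩
    f (xs ++ a ∷ b ∷ ys ++ post)     ≈⟨ alt xs a b (ys ++ post) ⟩
    - f (xs ++ b ∷ a ∷ ys ++ post)   ≡⟨ ≡.cong (-_ ∘ f) (Listₚ.++-assoc xs _ post) ⟨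
    - f ((xs ++ b ∷ a ∷ ys) ++ post) ∎

  Alternating-map : ∀ {S T : Set} {f : MV T} (h : S → T) → Alternating f → Alternating (f ∘ map h)
  Alternating-map {f = f} h alt xs a b ys = begin
    f (map h (xs ++ a ∷ b ∷ ys))               ≡⟨ ≡.cong f (Listₚ.map-++ h xs _) ⟩
    f (map h xs ++ h a ∷ h b ∷ map h ys)       ≈⟨ alt (map h xs) (h a) (h b) (map h ys) ⟩
    - f (map h xs ++ h b ∷ h a ∷ map h ys)     ≡⟨ ≡.cong (-_ ∘ f) (Listₚ.map-++ h xs _) ⟨
    - f (map h (xs ++ b ∷ a ∷ ys))             ∎

  Alternating-scalar : ∀ {S : Set} a → Alternating {S} (scalar a)
  Alternating-scalar a [] _ _ _ = sym -0#≈0#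
  Alternating-scalar a (_ ∷ _) _ _ _ = sym -0#≈0#

  Alternating-vec-∧ : ∀ {S : Set} (v : S → Carrier) {y : MV S} → Alternating y → Alternating (vec v ∧ y)
  Alternating-vec-∧ v {y} alt [] a b ys = begin
    (vec v ∧ y) (a ∷ b ∷ ys)                          ≈⟨ vec-∧-∷ v y a (b ∷ ys) ⟩
    v a * y (b ∷ ys) - (vec v ∧ (a ⌟ y)) (b ∷ ys)     ≈⟨ +-congˡ (-‿cong (vec-∧-∷ v (a ⌟ y) b ys)) ⟩
    v a * y (b ∷ ys) - (v b * y (a ∷ ys) - (vec v ∧ (b ⌟ (a ⌟ y))) ys)
      ≈⟨ +-congˡ (-‿cong (+-congˡ (-‿cong swapped))) ⟩
    v a * y (b ∷ ys) - (v b * y (a ∷ ys) - - (vec v ∧ (a ⌟ (b ⌟ y))) ys)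
      ≈⟨ exchange (v a * y (b ∷ ys)) (v b * y (a ∷ ys)) _ ⟩
    - (v b * y (a ∷ ys) - (v a * y (b ∷ ys) - (vec v ∧ (a ⌟ (b ⌟ y))) ys))
      ≈⟨ -‿cong (+-congˡ (-‿cong (vec-∧-∷ v (b ⌟ y) a ys))) ⟨
    - (v b * y (a ∷ ys) - (vec v ∧ (b ⌟ y)) (a ∷ ys))             ≈⟨ -‿cong (vec-∧-∷ v y b (a ∷ ys)) ⟨
    - (vec v ∧ y) (b ∷ a ∷ ys)                                     ∎
    where
    swapped : (vec v ∧ (b ⌟ (a ⌟ y))) ys ≈ - (vec v ∧ (a ⌟ (b ⌟ y))) ys
    swapped = begin
      (vec v ∧ (b ⌟ (a ⌟ y))) ys
        ≈⟨ ∧-cong (λ _ → refl) (λ L → trans (alt [] a b L) (sym (-1*x≈-x _))) ys ⟩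
      (vec v ∧ ((- 1#) · (a ⌟ (b ⌟ y)))) ys  ≈⟨ ∧-· (- 1#) (vec v) _ ys ⟩
      - 1# * (vec v ∧ (a ⌟ (b ⌟ y))) ys      ≈⟨ -1*x≈-x _ ⟩
      - (vec v ∧ (a ⌟ (b ⌟ y))) ys           ∎
    exchange : ∀ P Q W → P - (Q - - W) ≈ - (Q - (P - W))
    exchange P Q W = begin
      P - (Q - - W)        ≈⟨ +-congˡ (⁻¹-∙-comm Q (- - W)) ⟨
      P + (- Q + - - - W)  ≈⟨ +-congˡ (+-congˡ (⁻¹-involutive (- W))) ⟩
      P + (- Q + - W)      ≈⟨ solve 3 (λ P Q W → (P :+ (Q :+ W)) := (Q :+ (P :+ W))) refl P (- Q) (- W) ⟩
      - Q + (P - W)        ≈⟨ +-congˡ (⁻¹-involutive (P - W)) ⟨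
      - Q + - - (P - W)    ≈⟨ ⁻¹-∙-comm Q (- (P - W)) ⟩
      - (Q - (P - W))      ∎
  Alternating-vec-∧ v {y} alt (d ∷ xs) a b ys = begin
    (vec v ∧ y) (d ∷ xs ++ a ∷ b ∷ ys)                                      ≈⟨ vec-∧-∷ v y d _ ⟩
    v d * y (xs ++ a ∷ b ∷ ys) - (vec v ∧ (d ⌟ y)) (xs ++ a ∷ b ∷ ys)
      ≈⟨ +-cong (*-congˡ (alt xs a b ys))
                (-‿cong (Alternating-vec-∧ v (Alternating-⌟ {f = y} d alt) xs a b ys)) ⟩
    v d * - y (xs ++ b ∷ a ∷ ys) - - (vec v ∧ (d ⌟ y)) (xs ++ b ∷ a ∷ ys)
      ≈⟨ +-congʳ (-‿distribʳ-* (v d) _) ⟨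
    - (v d * y (xs ++ b ∷ a ∷ ys)) - - (vec v ∧ (d ⌟ y)) (xs ++ b ∷ a ∷ ys)
      ≈⟨ ⁻¹-∙-comm _ _ ⟩
    - (v d * y (xs ++ b ∷ a ∷ ys) - (vec v ∧ (d ⌟ y)) (xs ++ b ∷ a ∷ ys))  ≈⟨ -‿cong (vec-∧-∷ v y d _) ⟨
    - (vec v ∧ y) (d ∷ xs ++ b ∷ a ∷ ys)                                    ∎

  Alternating-⋀ : ∀ {S : Set} (vs : List (S → Carrier)) → Alternating (⋀ (map vec vs))
  Alternating-⋀ [] = Alternating-scalar 1#
  Alternating-⋀ (v ∷ vs) = Alternating-vec-∧ v (Alternating-⋀ vs)

  IsExtensor⇒Alternating : ∀ {S : Set} {N : MV S} → IsExtensor N → Alternating N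
  IsExtensor⇒Alternating (inj₁ (a , N≋a)) = Alternating-≋ N≋a (Alternating-scalar a)
  IsExtensor⇒Alternating (inj₂ (vs , N≋⋀vs)) = Alternating-≋ N≋⋀vs (Alternating-⋀ vs)

  move-to-front : ∀ {S : Set} {f : MV S} → Alternating f → ∀ L s R →
                  f (L ++ s ∷ R) ≈ sgn (length L) * f (s ∷ L ++ R)
  move-to-front alt [] s R = sym (*-identityˡ _)
  move-to-front {f = f} alt (l ∷ L) s R = begin
    f (l ∷ L ++ s ∷ R)                       ≈⟨ move-to-front {f = l ⌟ f} (Alternating-⌟ {f = f} l alt) L s R ⟩
    sgn (length L) * f (l ∷ s ∷ L ++ R)      ≈⟨ *-congˡ (alt [] l s (L ++ R)) ⟩
    sgn (length L) * - f (s ∷ l ∷ L ++ R)    ≈⟨ -‿distribʳ-* _ _ ⟨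
    - (sgn (length L) * f (s ∷ l ∷ L ++ R))  ≈⟨ -‿distribˡ-* _ _ ⟩
    - sgn (length L) * f (s ∷ l ∷ L ++ R)    ∎

  swap-blocks : ∀ {S : Set} {f : MV S} → Alternating f → ∀ A W ys →
                f (A ++ W ++ ys) ≈ sgn (length A ℕ.* length W) * f (W ++ A ++ ys)
  swap-blocks alt [] W ys = sym (*-identityˡ _)
  swap-blocks {f = f} alt (a ∷ A) W ys = begin
    f (a ∷ A ++ W ++ ys)                                ≈⟨ swap-blocks {f = a ⌟ f} (Alternating-⌟ {f = f} a alt) A W ys ⟩
    sgn (length A ℕ.* length W) * f (a ∷ W ++ A ++ ys)
      ≈⟨ *-congˡ (sgn-flip (length W) (move-to-front {f = f} alt W a (A ++ ys))) ⟩
    sgn (length A ℕ.* length W) * (sgn (length W) * f (W ++ a ∷ A ++ ys))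
      ≈⟨ solve 3 (λ a b x → (a :* (b :* x)) := ((b :* a) :* x)) refl _ _ _ ⟩
    sgn (length W) * sgn (length A ℕ.* length W) * f (W ++ a ∷ A ++ ys)
      ≈⟨ *-congʳ (sgn-+ (length W) _) ⟨
    sgn (length (a ∷ A) ℕ.* length W) * f (W ++ a ∷ A ++ ys) ∎

  alternating-product-resp-↭ : ∀ {S : Set} {X Y : List S} → X ↭ Y → ∀ {f g : MV S} →
                               Alternating f → Alternating g → f X * g X ≈ f Y * g Y
  alternating-product-resp-↭ ↭.refl altf altg = refl
  alternating-product-resp-↭ (↭.prep x X↭Y) {f} {g} altf altg =
    alternating-product-resp-↭ X↭Y {x ⌟ f} {x ⌟ g} (Alternating-⌟ {f = f} x altf) (Alternating-⌟ {f = g} x altg)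
  alternating-product-resp-↭ {X = x ∷ y ∷ X} (↭.swap x y X↭Y) {f} {g} altf altg = begin
    f (x ∷ y ∷ X) * g (x ∷ y ∷ X)      ≈⟨ *-cong (altf [] x y X) (altg [] x y X) ⟩
    - f (y ∷ x ∷ X) * - g (y ∷ x ∷ X)  ≈⟨ -x*-y≈x*y _ _ ⟩
    f (y ∷ x ∷ X) * g (y ∷ x ∷ X)
      ≈⟨ alternating-product-resp-↭ X↭Y {x ⌟ (y ⌟ f)} {x ⌟ (y ⌟ g)}
           (Alternating-⌟ {f = y ⌟ f} x (Alternating-⌟ {f = f} y altf))
           (Alternating-⌟ {f = y ⌟ g} x (Alternating-⌟ {f = g} y altg)) ⟩
    f (y ∷ x ∷ _) * g (y ∷ x ∷ _)      ∎
  alternating-product-resp-↭ (↭.trans X↭Y Y↭Z) altf altg =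
    trans (alternating-product-resp-↭ X↭Y altf altg) (alternating-product-resp-↭ Y↭Z altf altg)

  -- Shuffles

  data Shuffle {S : Set} : List S → List S → List S → Carrier → Set c where
    []    : Shuffle [] [] [] 1#
    left  : ∀ {s C L R σ} → Shuffle C L R σ → Shuffle (s ∷ C) (s ∷ L) R σ
    right : ∀ {s C L R σ} → Shuffle C L R σ → Shuffle (s ∷ C) L (s ∷ R) (signLen L σ)

  splitStep : ∀ {S : Set} → S → List S × List S × Carrier → List (List S × List S × Carrier)
  splitStep s (L , R , σ) = (s ∷ L , R , σ) ∷ (L , s ∷ R , signLen L σ) ∷ []

  IsSplitOf : ∀ {S : Set} → List S → List S × List S × Carrier → Set c
  IsSplitOf C (L , R , σ) = Shuffle C L R σ

  splits-Shuffle : ∀ {S : Set} (C : List S) → All (IsSplitOf C) (splits C)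
  splits-Shuffle [] = [] ∷ []
  splits-Shuffle (s ∷ C) = step (splits-Shuffle C)
    where
    step : ∀ {l} → All (IsSplitOf C) l →
           All (IsSplitOf (s ∷ C)) (concatMap (splitStep s) l)
    step [] = []
    step (sh ∷ shs) = left sh ∷ right sh ∷ step shs

  mapSplit : ∀ {S T : Set} → (S → T) → List S × List S × Carrier → List T × List T × Carrier
  mapSplit f (L , R , σ) = (map f L , map f R , σ)

  signLen-map : ∀ {S T : Set} (f : S → T) (L : List S) σ → signLen (map f L) σ ≡ signLen L σ
  signLen-map f [] σ = ≡.refl
  signLen-map f (_ ∷ L) σ = ≡.cong -_ (signLen-map f L σ)

  splits-map : ∀ {S T : Set} (f : S → T) (C : List S) → splits (map f C) ≡ map (mapSplit f) (splits C)
  splits-map f [] = ≡.refl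
  splits-map f (s ∷ C) = ≡.trans (≡.cong (concatMap _) (splits-map f C)) (step (splits C))
    where
    step : ∀ l → concatMap (splitStep (f s)) (map (mapSplit f) l) ≡ map (mapSplit f) (concatMap (splitStep s) l)
    step [] = ≡.refl
    step ((L , R , σ) ∷ l) =
      ≡.cong₂ (λ τ rest → (f s ∷ map f L , map f R , σ) ∷ (map f L , f s ∷ map f R , τ) ∷ rest)
              (signLen-map f L σ) (step l)

  map-splits≡subsetsC : ∀ {S : Set} (C : List S) → map (λ (L , R , _) → (L , R)) (splits C) ≡ subsetsC C
  map-splits≡subsetsC [] = ≡.refl
  map-splits≡subsetsC (s ∷ C) = ≡.trans (step (splits C)) (≡.cong (concatMap _) (map-splits≡subsetsC C))
    where
    step : ∀ l → map (λ (L , R , _) → (L , R)) (concatMap (splitStep s) l)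
               ≡ concatMap (λ (A , B) → (s ∷ A , B) ∷ (A , s ∷ B) ∷ []) (map (λ (L , R , _) → (L , R)) l)
    step [] = ≡.refl
    step ((L , R , σ) ∷ l) = ≡.cong (λ rest → (s ∷ L , R) ∷ (L , s ∷ R) ∷ rest) (step l)

  Shuffle-↭ : ∀ {S : Set} {C L R : List S} {σ} → Shuffle C L R σ → L ++ R ↭ C
  Shuffle-↭ [] = ↭.refl
  Shuffle-↭ (left sh) = ↭.prep _ (Shuffle-↭ sh)
  Shuffle-↭ (right {s = s} {L = L} {R = R} sh) = ↭.trans (↭ₚ.shift s L R) (↭.prep s (Shuffle-↭ sh))

  Shuffle-Πl : ∀ {S : Set} {C L R : List S} {σ} → Shuffle C L R σ → ∀ (w : S → Carrier) →
               Πl (map w L) * Πl (map w R) ≈ Πl (map w C)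
  Shuffle-Πl [] w = *-identityˡ _
  Shuffle-Πl (left sh) w = trans (*-assoc _ _ _) (*-congˡ (Shuffle-Πl sh w))
  Shuffle-Πl (right {s = s} sh) w =
    trans (solve 3 (λ a b d → (a :* (b :* d)) := (b :* (a :* d))) refl _ (w s) _) (*-congˡ (Shuffle-Πl sh w))

  Shuffle-sign-sq : ∀ {S : Set} {C L R : List S} {σ} → Shuffle C L R σ → σ * σ ≈ 1#
  Shuffle-sign-sq [] = *-identityˡ _
  Shuffle-sign-sq (left sh) = Shuffle-sign-sq sh
  Shuffle-sign-sq (right {L = L} {σ = σ} sh) = begin
    signLen L σ * signLen L σ                            ≈⟨ *-cong (signLen≈sgn L σ) (signLen≈sgn L σ) ⟩
    sgn (length L) * σ * (sgn (length L) * σ)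
      ≈⟨ solve 2 (λ k σ → ((k :* σ) :* (k :* σ)) := ((k :* k) :* (σ :* σ))) refl _ σ ⟩
    sgn (length L) * sgn (length L) * (σ * σ)            ≈⟨ *-cong (sgn-sq (length L)) (Shuffle-sign-sq sh) ⟩
    1# * 1#                                              ≈⟨ *-identityˡ _ ⟩
    1#                                                   ∎

  Shuffle-sign : ∀ {S : Set} {C L R : List S} {σ} → Shuffle C L R σ → ∀ {f : MV S} → Alternating f →
                 f (L ++ R) ≈ σ * f C
  Shuffle-sign [] alt = sym (*-identityˡ _)
  Shuffle-sign (left {s = s} sh) {f} alt = Shuffle-sign sh {s ⌟ f} (Alternating-⌟ {f = f} s alt)
  Shuffle-sign (right {s = s} {C} {L} {R} {σ} sh) {f} alt = begin
    f (L ++ s ∷ R)                       ≈⟨ move-to-front {f = f} alt L s R ⟩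
    sgn (length L) * f (s ∷ L ++ R)      ≈⟨ *-congˡ (Shuffle-sign sh {s ⌟ f} (Alternating-⌟ {f = f} s alt)) ⟩
    sgn (length L) * (σ * f (s ∷ C))     ≈⟨ *-assoc _ _ _ ⟨
    sgn (length L) * σ * f (s ∷ C)       ≈⟨ *-congʳ (signLen≈sgn L σ) ⟨
    signLen L σ * f (s ∷ C)              ∎

  -- Elements not involving a generator

  VanishesAt : ∀ {S : Set} → S → MV S → Set ℓ
  VanishesAt s x = ∀ L R → x (L ++ s ∷ R) ≈ 0#

  VanishesAt-involute : ∀ {S : Set} {s : S} {x : MV S} → VanishesAt s x → VanishesAt s (involute x)
  VanishesAt-involute x≈0 L R = trans (signLen-cong (L ++ _ ∷ R) (x≈0 L R)) (signLen-zero (L ++ _ ∷ R))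

  VanishesAt-vec-∧ : ∀ {S : Set} {s : S} (v : S → Carrier) {y : MV S} → v s ≈ 0# → VanishesAt s y →
                     VanishesAt s (vec v ∧ y)
  VanishesAt-vec-∧ {s = s} v {y} vs≈0 y≈0 [] R = begin
    (vec v ∧ y) (s ∷ R)                        ≈⟨ vec-∧-∷ v y s R ⟩
    v s * y R - (vec v ∧ (s ⌟ y)) R
      ≈⟨ +-cong (trans (*-congʳ vs≈0) (zeroˡ _)) (-‿cong (∧-zeroʳ (vec v) (y≈0 []) R)) ⟩
    0# - 0#                                    ≈⟨ 0#-0#≈0# ⟩
    0#                                         ∎
  VanishesAt-vec-∧ {s = s} v {y} vs≈0 y≈0 (d ∷ L) R = begin
    (vec v ∧ y) (d ∷ L ++ s ∷ R)                                ≈⟨ vec-∧-∷ v y d _ ⟩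
    v d * y (L ++ s ∷ R) - (vec v ∧ (d ⌟ y)) (L ++ s ∷ R)
      ≈⟨ +-cong (trans (*-congˡ (y≈0 L R)) (zeroʳ _))
                (-‿cong (VanishesAt-vec-∧ v vs≈0 (λ L′ → y≈0 (d ∷ L′)) L R)) ⟩
    0# - 0#                                                     ≈⟨ 0#-0#≈0# ⟩
    0#                                                          ∎

  VanishesAt-⋀ : ∀ {I S : Set} {s : S} (fv : I → S → Carrier) → (∀ a → fv a s ≈ 0#) →
                 ∀ A → VanishesAt s (⋀ (map (vec ∘ fv) A))
  VanishesAt-⋀ fv fv≈0 [] [] R = refl
  VanishesAt-⋀ fv fv≈0 [] (_ ∷ _) R = refl
  VanishesAt-⋀ fv fv≈0 (a ∷ A) = VanishesAt-vec-∧ (fv a) (fv≈0 a) (VanishesAt-⋀ fv fv≈0 A)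

  ∧-prefixˡ : ∀ {S : Set} {x y : MV S} W → All (λ s → VanishesAt s y) W → ∀ C →
              (x ∧ y) (W ++ C) ≈ ((λ L → x (W ++ L)) ∧ y) C
  ∧-prefixˡ [] [] C = refl
  ∧-prefixˡ {x = x} {y} (s ∷ W) (y≈0 ∷ W≈0) C = begin
    (x ∧ y) (s ∷ W ++ C)                                         ≈⟨ ∧-∷ x y s (W ++ C) ⟩
    ((s ⌟ x) ∧ y) (W ++ C) + (involute x ∧ (s ⌟ y)) (W ++ C)     ≈⟨ +-congˡ (∧-zeroʳ (involute x) (y≈0 []) (W ++ C)) ⟩
    ((s ⌟ x) ∧ y) (W ++ C) + 0#                                  ≈⟨ +-identityʳ _ ⟩
    ((s ⌟ x) ∧ y) (W ++ C)                                       ≈⟨ ∧-prefixˡ {x = s ⌟ x} W W≈0 C ⟩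
    ((λ L → x (s ∷ W ++ L)) ∧ y) C                               ∎

  ∧-prefixʳ : ∀ {S : Set} {x y : MV S} W → All (λ s → VanishesAt s x) W → ∀ C →
              (x ∧ y) (W ++ C) ≈ ((λ L → sgn (length W ℕ.* length L) * x L) ∧ (λ R → y (W ++ R))) C
  ∧-prefixʳ [] [] C = ∧-cong (λ L → sym (*-identityˡ _)) (λ _ → refl) C
  ∧-prefixʳ {x = x} {y} (s ∷ W) (x≈0 ∷ W≈0) C = begin
    (x ∧ y) (s ∷ W ++ C)                                         ≈⟨ ∧-∷ x y s (W ++ C) ⟩
    ((s ⌟ x) ∧ y) (W ++ C) + (involute x ∧ (s ⌟ y)) (W ++ C)     ≈⟨ +-congʳ (∧-zeroˡ y (x≈0 []) (W ++ C)) ⟩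
    0# + (involute x ∧ (s ⌟ y)) (W ++ C)                         ≈⟨ +-identityˡ _ ⟩
    (involute x ∧ (s ⌟ y)) (W ++ C)
      ≈⟨ ∧-prefixʳ {x = involute x} {s ⌟ y} W (All.map (VanishesAt-involute {x = x}) W≈0) C ⟩
    ((λ L → sgn (length W ℕ.* length L) * involute x L) ∧ (λ R → y (s ∷ W ++ R))) C
      ≈⟨ ∧-cong twist (λ _ → refl) C ⟩
    ((λ L → sgn (length (s ∷ W) ℕ.* length L) * x L) ∧ (λ R → y (s ∷ W ++ R))) C ∎
    where
    twist : ∀ L → sgn (length W ℕ.* length L) * involute x L ≈ sgn (length (s ∷ W) ℕ.* length L) * x L
    twist L = begin
      sgn (length W ℕ.* length L) * signLen L (x L)             ≈⟨ *-congˡ (signLen≈sgn L (x L)) ⟩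
      sgn (length W ℕ.* length L) * (sgn (length L) * x L)
        ≈⟨ solve 3 (λ a b x → (a :* (b :* x)) := ((b :* a) :* x)) refl _ _ _ ⟩
      sgn (length L) * sgn (length W ℕ.* length L) * x L        ≈⟨ *-congʳ (sgn-+ (length L) _) ⟨
      sgn (length (s ∷ W) ℕ.* length L) * x L                   ∎

  -- Expansion in the standard basis

  ⋀-relabel : ∀ {I S T : Set} (φ : S → T) (w : S → Carrier) (fv : I → T → Carrier) (gv : I → S → Carrier) →
              (∀ a s → fv a (φ s) ≈ w s * gv a s) → ∀ A X →
              ⋀ (map (vec ∘ fv) A) (map φ X) ≈ Πl (map w X) * ⋀ (map (vec ∘ gv) A) X
  ⋀-relabel φ w fv gv fv∘φ [] [] = sym (*-identityˡ _)
  ⋀-relabel φ w fv gv fv∘φ [] (_ ∷ _) = sym (zeroʳ _)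
  ⋀-relabel {S = S} {T} φ w fv gv fv∘φ (a ∷ A) X = begin
    Σl (map term′ (splits (map φ X)))                   ≡⟨ ≡.cong (Σl ∘ map term′) (splits-map φ X) ⟩
    Σl (map term′ (map (mapSplit φ) (splits X)))         ≡⟨ Σl-map term′ (mapSplit φ) (splits X) ⟩
    Σl (map (term′ ∘ mapSplit φ) (splits X))             ≈⟨ Σl-cong-All (All.map relabel-term (splits-Shuffle X)) ⟩
    Σl (map (λ t → Πl (map w X) * term t) (splits X))   ≈⟨ *-distribˡ-Σl _ term (splits X) ⟨
    Πl (map w X) * Σl (map term (splits X))              ∎
    where
    term′ : List T × List T × Carrier → Carrier
    term′ (L , R , σ) = σ * (vec (fv a) L * ⋀ (map (vec ∘ fv) A) R)
    term : List S × List S × Carrier → Carrier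
    term (L , R , σ) = σ * (vec (gv a) L * ⋀ (map (vec ∘ gv) A) R)
    vec-relabel : ∀ L → vec (fv a) (map φ L) ≈ Πl (map w L) * vec (gv a) L
    vec-relabel [] = sym (zeroʳ _)
    vec-relabel (s ∷ []) = trans (fv∘φ a s) (*-congʳ (sym (*-identityʳ _)))
    vec-relabel (_ ∷ _ ∷ _) = sym (zeroʳ _)
    relabel-term : ∀ {t} → IsSplitOf X t → term′ (mapSplit φ t) ≈ Πl (map w X) * term t
    relabel-term {L , R , σ} sh = begin
      σ * (vec (fv a) (map φ L) * ⋀ (map (vec ∘ fv) A) (map φ R))
        ≈⟨ *-congˡ (*-cong (vec-relabel L) (⋀-relabel φ w fv gv fv∘φ A R)) ⟩
      σ * (Πl (map w L) * vec (gv a) L * (Πl (map w R) * ⋀ (map (vec ∘ gv) A) R))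
        ≈⟨ solve 5 (λ σ a b c d → (σ :* ((a :* b) :* (c :* d))) := ((a :* c) :* (σ :* (b :* d)))) refl σ _ _ _ _ ⟩
      Πl (map w L) * Πl (map w R) * term (L , R , σ)     ≈⟨ *-congʳ (Shuffle-Πl sh w) ⟩
      Πl (map w X) * term (L , R , σ)                    ∎

  ⋀-vec-cong : ∀ {I S : Set} {f : I → MV S} {fv : I → S → Carrier} → (∀ a → f a ≋ vec (fv a)) →
               ∀ A → ⋀ (map f A) ≋ ⋀ (map (vec ∘ fv) A)
  ⋀-vec-cong f≋fv [] _ = refl
  ⋀-vec-cong f≋fv (a ∷ A) = ∧-cong (f≋fv a) (⋀-vec-cong f≋fv A)

  sumMV-eval : ∀ {S : Set} (xs : List (MV S)) L → sumMV xs L ≈ Σl (map (λ x → x L) xs)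
  sumMV-eval [] [] = refl
  sumMV-eval [] (_ ∷ _) = refl
  sumMV-eval (x ∷ xs) L = +-congˡ (sumMV-eval xs L)

  induced-eval : ∀ {S T : Set} enum (f : S → MV T) (N : MV S) L →
                 induced enum f N L ≈ Σl (map (λ (A , _) → N A * ⋀ (map f A) L) (subsetsC enum))
  induced-eval enum f N L = trans (sumMV-eval (map _ (subsetsC enum)) L) (reflexive (Σl-map (λ x → x L) _ (subsetsC enum)))

  induced-VanishesAt : ∀ {S T : Set} enum (f : S → MV T) (fv : S → T → Carrier) → (∀ a → f a ≋ vec (fv a)) →
                       ∀ {t} → (∀ a → fv a t ≈ 0#) → ∀ N → VanishesAt t (induced enum f N)
  induced-VanishesAt enum f fv f≋fv fv≈0 N L R = trans (induced-eval enum f N _) (Σl-zero (subsetsC enum) (λ (A , _) →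
    trans (*-congˡ (trans (⋀-vec-cong f≋fv A _) (VanishesAt-⋀ fv fv≈0 A L R))) (zeroʳ _)))

  module StandardBasis {S : Set} (_≟_ : DecidableEquality S) where
    open DecMembership _≟_ using (_∈?_)

    δ : S → S → Carrier
    δ s t = if does (s ≟ t) then 1# else 0#

    δ-refl : ∀ s → δ s s ≈ 1#
    δ-refl s with s ≟ s
    ... | yes _ = refl
    ... | no s≢s = ⊥-elim (s≢s ≡.refl)

    δ-≢ : ∀ {s t} → s ≢ t → δ s t ≈ 0#
    δ-≢ {s} {t} s≢t with s ≟ t
    ... | yes s≡t = ⊥-elim (s≢t s≡t)
    ... | no _ = refl

    δ-weight : ∀ (w : S → Carrier) x a → w a * δ x a ≈ w x * δ x a
    δ-weight w x a with x ≟ a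
    ... | yes ≡.refl = refl
    ... | no _ = trans (zeroʳ _) (sym (zeroʳ _))

    unit-∧-absent : ∀ e (y : MV S) {X} → e ∉ X → (unit _≟_ e ∧ y) X ≈ 0#
    unit-∧-absent e y {[]} e∉X = trans (+-identityʳ _) (trans (*-identityˡ _) (zeroˡ _))
    unit-∧-absent e y {s ∷ X} e∉X = begin
      (unit _≟_ e ∧ y) (s ∷ X)                   ≈⟨ vec-∧-∷ _ y s X ⟩
      δ s e * y X - (unit _≟_ e ∧ (s ⌟ y)) X
        ≈⟨ +-cong (trans (*-congʳ (δ-≢ (λ s≡e → e∉X (here (≡.sym s≡e))))) (zeroˡ _))
                  (-‿cong (unit-∧-absent e (s ⌟ y) (e∉X ∘ there))) ⟩
      0# - 0#                                    ≈⟨ 0#-0#≈0# ⟩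
      0#                                         ∎

    unit-∧-present : ∀ e (y : MV S) L R → e ∉ L → e ∉ R →
                     (unit _≟_ e ∧ y) (L ++ e ∷ R) ≈ sgn (length L) * y (L ++ R)
    unit-∧-present e y [] R e∉L e∉R = begin
      (unit _≟_ e ∧ y) (e ∷ R)                   ≈⟨ vec-∧-∷ _ y e R ⟩
      δ e e * y R - (unit _≟_ e ∧ (e ⌟ y)) R     ≈⟨ +-cong (*-congʳ (δ-refl e)) (-‿cong (unit-∧-absent e (e ⌟ y) e∉R)) ⟩
      1# * y R - 0#                              ≈⟨ trans (+-congˡ -0#≈0#) (+-identityʳ _) ⟩
      1# * y R                                   ∎
    unit-∧-present e y (d ∷ L) R e∉L e∉R = begin
      (unit _≟_ e ∧ y) (d ∷ L ++ e ∷ R)                        ≈⟨ vec-∧-∷ _ y d _ ⟩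
      δ d e * y (L ++ e ∷ R) - (unit _≟_ e ∧ (d ⌟ y)) (L ++ e ∷ R)
        ≈⟨ +-cong (trans (*-congʳ (δ-≢ (λ d≡e → e∉L (here (≡.sym d≡e))))) (zeroˡ _))
                  (-‿cong (unit-∧-present e (d ⌟ y) L R (e∉L ∘ there) e∉R)) ⟩
      0# - sgn (length L) * y (d ∷ L ++ R)                     ≈⟨ +-identityˡ _ ⟩
      - (sgn (length L) * y (d ∷ L ++ R))                      ≈⟨ -‿distribˡ-* _ _ ⟩
      sgn (length (d ∷ L)) * y (d ∷ L ++ R)                    ∎

    expansion : List S → MV S → MV S
    expansion enum N X = Σl (map (λ (A , _) → N A * ⋀ (map (unit _≟_) A) X) (subsetsC enum))

    headSum : S → List S → MV S → MV S
    headSum e enum N X = Σl (map (λ (A , _) → N (e ∷ A) * (unit _≟_ e ∧ ⋀ (map (unit _≟_) A)) X) (subsetsC enum))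

    expansion-∷ : ∀ e enum N X → expansion (e ∷ enum) N X ≈ headSum e enum N X + expansion enum N X
    expansion-∷ e enum N X = Σl-concatMap-pair _ (λ (A , B) → (e ∷ A , B)) (λ (A , B) → (A , e ∷ B)) (subsetsC enum)

    headSum-absent : ∀ {e} enum N {X} → e ∉ X → headSum e enum N X ≈ 0#
    headSum-absent {e} enum N e∉X =
      Σl-zero (subsetsC enum) (λ (A , _) → trans (*-congˡ (unit-∧-absent e _ e∉X)) (zeroʳ _))

    headSum-present : ∀ {e} enum N L R → e ∉ L → e ∉ R →
                      headSum e enum N (L ++ e ∷ R) ≈ sgn (length L) * expansion enum (e ⌟ N) (L ++ R)
    headSum-present {e} enum N L R e∉L e∉R = trans
      (Σl-cong (subsetsC enum) (λ (A , _) → trans (*-congˡ (unit-∧-present e _ L R e∉L e∉R))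
        (solve 3 (λ n k x → (n :* (k :* x)) := (k :* (n :* x))) refl _ _ _)))
      (sym (*-distribˡ-Σl _ _ (subsetsC enum)))

    expansion-vanishes : ∀ enum N {z X} → Unique X → z ∈ X → z ∉ enum → expansion enum N X ≈ 0#
    expansion-vanishes [] N {X = _ ∷ _} uX z∈X z∉enum = trans (+-identityʳ _) (zeroʳ _)
    expansion-vanishes (e ∷ enum) N {z} {X} uX z∈X z∉enum with e ∈? X
    ... | no e∉X = begin
      expansion (e ∷ enum) N X                  ≈⟨ expansion-∷ e enum N X ⟩
      headSum e enum N X + expansion enum N X
        ≈⟨ +-cong (headSum-absent enum N e∉X) (expansion-vanishes enum N uX z∈X (z∉enum ∘ there)) ⟩
      0# + 0#                                   ≈⟨ +-identityˡ 0# ⟩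
      0#                                        ∎
    ... | yes e∈X with ∈-∃++ e∈X
    ... | L , R , ≡.refl with Unique-middle L uX
    ... | e∉LR , uLR = begin
      expansion (e ∷ enum) N (L ++ e ∷ R)
        ≈⟨ expansion-∷ e enum N _ ⟩
      headSum e enum N (L ++ e ∷ R) + expansion enum N (L ++ e ∷ R)
        ≈⟨ +-cong (headSum-present enum N L R (e∉LR ∘ ∈-++⁺ˡ) (e∉LR ∘ ∈-++⁺ʳ L))
                  (expansion-vanishes enum N uX z∈X (z∉enum ∘ there)) ⟩
      sgn (length L) * expansion enum (e ⌟ N) (L ++ R) + 0#
        ≈⟨ +-congʳ (*-congˡ (expansion-vanishes enum (e ⌟ N) uLR (∈-middle⁻ L z∈X (z∉enum ∘ here))
                                                                   (z∉enum ∘ there))) ⟩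
      sgn (length L) * 0# + 0#
        ≈⟨ trans (+-identityʳ _) (zeroʳ _) ⟩
      0#                                                              ∎

    expansion-reproduces : ∀ enum {N} → Alternating N → Unique enum → ∀ {X} → Unique X → All (_∈ enum) X →
                           expansion enum N X ≈ N X
    expansion-reproduces [] alt _ {[]} _ [] = trans (+-identityʳ _) (*-identityʳ _)
    expansion-reproduces (e ∷ enum) {N} alt (e∉enum ∷ uenum) {X} uX X⊆ with e ∈? X
    ... | no e∉X = begin
      expansion (e ∷ enum) N X                  ≈⟨ expansion-∷ e enum N X ⟩
      headSum e enum N X + expansion enum N X
        ≈⟨ +-cong (headSum-absent enum N e∉X) (expansion-reproduces enum alt uenum uX X⊆enum) ⟩
      0# + N X                                  ≈⟨ +-identityˡ _ ⟩
      N X                                       ∎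
      where
      X⊆enum : All (_∈ enum) X
      X⊆enum = All.tabulate (λ z∈X → Any.tail (λ z≡e → e∉X (≡.subst (_∈ X) z≡e z∈X)) (All.lookup X⊆ z∈X))
    ... | yes e∈X with ∈-∃++ e∈X
    ... | L , R , ≡.refl with Unique-middle L uX
    ... | e∉LR , uLR = begin
      expansion (e ∷ enum) N (L ++ e ∷ R)
        ≈⟨ expansion-∷ e enum N _ ⟩
      headSum e enum N (L ++ e ∷ R) + expansion enum N (L ++ e ∷ R)
        ≈⟨ +-cong (headSum-present enum N L R (e∉LR ∘ ∈-++⁺ˡ) (e∉LR ∘ ∈-++⁺ʳ L))
                  (expansion-vanishes enum N uX e∈X (Uniqueₚ.Unique[x∷xs]⇒x∉xs (e∉enum ∷ uenum))) ⟩
      sgn (length L) * expansion enum (e ⌟ N) (L ++ R) + 0#  ≈⟨ +-identityʳ _ ⟩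
      sgn (length L) * expansion enum (e ⌟ N) (L ++ R)
        ≈⟨ *-congˡ (expansion-reproduces enum (Alternating-⌟ {f = N} e alt) uenum uLR LR⊆enum) ⟩
      sgn (length L) * N (e ∷ L ++ R)                         ≈⟨ move-to-front {f = N} alt L e R ⟨
      N (L ++ e ∷ R)                                          ∎
      where
      LR⊆enum : All (_∈ enum) (L ++ R)
      LR⊆enum = All.tabulate (λ z∈LR → Any.tail (λ z≡e → e∉LR (≡.subst (_∈ L ++ R) z≡e z∈LR))
                                                 (All.lookup X⊆ (∈-middle⁺ L z∈LR)))

    induced-image : ∀ {T : Set} enum (f : S → MV T) (fv : S → T → Carrier) → (∀ a → f a ≋ vec (fv a)) →
                    (φ : S → T) (w : S → Carrier) → (∀ a s → fv a (φ s) ≈ w s * δ s a) →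
                    ∀ {N} → Alternating N → Unique enum → ∀ {X} → Unique X → All (_∈ enum) X →
                    induced enum f N (map φ X) ≈ Πl (map w X) * N X
    induced-image enum f fv f≋fv φ w fv∘φ {N} alt uenum {X} uX X⊆enum = begin
      induced enum f N (map φ X)
        ≈⟨ induced-eval enum f N (map φ X) ⟩
      Σl (map (λ (A , _) → N A * ⋀ (map f A) (map φ X)) (subsetsC enum))
        ≈⟨ Σl-cong (subsetsC enum) (λ (A , _) →
             trans (*-congˡ (trans (⋀-vec-cong f≋fv A _) (⋀-relabel φ w fv (λ a s → δ s a) fv∘φ A X)))
                   (solve 3 (λ n w x → (n :* (w :* x)) := (w :* (n :* x))) refl _ _ _)) ⟩
      Σl (map (λ (A , _) → Πl (map w X) * (N A * ⋀ (map (unit _≟_) A) X)) (subsetsC enum))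
        ≈⟨ *-distribˡ-Σl _ _ (subsetsC enum) ⟨
      Πl (map w X) * expansion enum N X
        ≈⟨ *-congˡ (expansion-reproduces enum alt uenum uX X⊆enum) ⟩
      Πl (map w X) * N X ∎

  δ-injective : ∀ {S T : Set} (_≟S_ : DecidableEquality S) (_≟T_ : DecidableEquality T) {φ : S → T} →
                (∀ {x y} → φ x ≡ φ y → x ≡ y) →
                ∀ x a → StandardBasis.δ _≟T_ (φ x) (φ a) ≈ StandardBasis.δ _≟S_ x a
  δ-injective _≟S_ _≟T_ φ-inj x a with x ≟S a
  ... | yes ≡.refl = StandardBasis.δ-refl _≟T_ _
  ... | no x≢a = StandardBasis.δ-≢ _≟T_ (x≢a ∘ φ-inj)

-- Ported extensors

module PortedExtensor {c ℓ} (F : Field c ℓ) {p m : ℕ} (ε : List (PE p m) → Field.Carrier F)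
                      (εo : Ext.IsGroundOrientation F ε) (g r : Fin m → Field.Carrier F) where
  open Ext F
  open Exterior F
  open Ported ε g r
  open IsGroundOrientation εo
  open Complement (_≟PE_ {p} {m}) using (complementIn-resp-↭)
  open import Algebra.Properties.Ring ring using (-‿distribʳ-*)
  open import Relation.Binary.Reasoning.Setoid setoid
  private
    module G = StandardBasis (_≟G_ {p} {m})
    module P = StandardBasis (_≟PE_ {p} {m})

  ε-alternating : Alternating ε
  ε-alternating = ε-swap

  ε-sq : ∀ {xs} → Unique xs → ε xs * ε xs ≈ 1#
  ε-sq {xs} u with ε-distinct xs u
  ... | inj₁ ε≈1 = trans (*-cong ε≈1 ε≈1) (*-identityˡ 1#)
  ... | inj₂ ε≈-1 = trans (*-cong ε≈-1 ε≈-1) (trans (-x*-y≈x*y 1# 1#) (*-identityˡ 1#))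

  -- A complement depends only on the entries of the sequence, so every dual is alternating.
  dual-alternating : ∀ N → Alternating (dual N)
  dual-alternating N xs a b ys = begin
    N c₁ * ε (c₁ ++ xs ++ a ∷ b ∷ ys)      ≡⟨ ≡.cong (λ c → N c * ε (c ++ xs ++ a ∷ b ∷ ys)) c₁≡c₂ ⟩
    N c₂ * ε (c₂ ++ xs ++ a ∷ b ∷ ys)      ≈⟨ *-congˡ (Alternating-prefix {f = ε} c₂ ε-alternating xs a b ys) ⟩
    N c₂ * - ε (c₂ ++ xs ++ b ∷ a ∷ ys)    ≈⟨ -‿distribʳ-* _ _ ⟨
    - (N c₂ * ε (c₂ ++ xs ++ b ∷ a ∷ ys))  ∎
    where
    c₁ c₂ : List (PE p m)
    c₁ = complPE (xs ++ a ∷ b ∷ ys)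
    c₂ = complPE (xs ++ b ∷ a ∷ ys)
    c₁≡c₂ : c₁ ≡ c₂
    c₁≡c₂ = complementIn-resp-↭ (enumPE p m) (↭ₚ.++⁺ˡ xs (↭.swap a b ↭.refl))

  dual-complement : ∀ {N} → Alternating N → ∀ {X Y} → complPE X ↭ Y → dual N X ≈ N Y * ε (Y ++ X)
  dual-complement {N} altN {X} X̄↭Y =
    alternating-product-resp-↭ X̄↭Y {N} {λ C → ε (C ++ X)} altN (Alternating-suffix {f = ε} X ε-alternating)

  embed : (Fin p → Ground3 p m) → PE p m → Ground3 p m
  embed pX (inj₁ q) = pX q
  embed pX (inj₂ e) = ee e

  weight : (Fin m → Carrier) → PE p m → Carrier
  weight h (inj₁ _) = 1#
  weight h (inj₂ e) = h e

  generator : (Fin p → Ground3 p m) → (Fin m → Carrier) → PE p m → Ground3 p m → Carrier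
  generator pX h a t = weight h a * G.δ t (embed pX a)

  ι-gen≋generator : ∀ a → ι-gen a ≋ vec (generator pι g a)
  ι-gen≋generator (inj₁ q) L = trans (sym (*-identityˡ _)) (·-vec 1# _ L)
  ι-gen≋generator (inj₂ e) = ·-vec (g e) _

  υ-gen≋generator : ∀ a → υ-gen a ≋ vec (generator pυ r a)
  υ-gen≋generator (inj₁ q) L = trans (sym (*-identityˡ _)) (·-vec 1# _ L)
  υ-gen≋generator (inj₂ e) = ·-vec (r e) _

  module Embedding (pX : Fin p → Ground3 p m) (pX-injective : ∀ {q q′} → pX q ≡ pX q′ → q ≡ q′)
                   (pX≢ee : ∀ q e → pX q ≢ ee e) where

    embed-injective : ∀ {x y} → embed pX x ≡ embed pX y → x ≡ y
    embed-injective {inj₁ q} {inj₁ q′} eq = ≡.cong inj₁ (pX-injective eq)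
    embed-injective {inj₁ q} {inj₂ e} eq = ⊥-elim (pX≢ee q e eq)
    embed-injective {inj₂ e} {inj₁ q} eq = ⊥-elim (pX≢ee q e (≡.sym eq))
    embed-injective {inj₂ e} {inj₂ .e} ≡.refl = ≡.refl

    generator-embed : ∀ h a x → generator pX h a (embed pX x) ≈ weight h x * P.δ x a
    generator-embed h a x =
      trans (*-congˡ (δ-injective _≟PE_ _≟G_ embed-injective x a)) (P.δ-weight (weight h) x a)

  ιg-image : ∀ {N} → Alternating N → ∀ {X} → Unique X → ιg N (map (embed pι) X) ≈ Πl (map (weight g) X) * N X
  ιg-image altN uX = P.induced-image (enumPE p m) ι-gen (generator pι g) ι-gen≋generator (embed pι) (weight g)
    (Embedding.generator-embed pι (λ { ≡.refl → ≡.refl }) (λ _ _ ()) g) altN (enumPE-unique p m) uX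
    (All.tabulate (λ {z} _ → ∈-enumPE z))

  υr-image : ∀ {N} → Alternating N → ∀ {X} → Unique X → υr N (map (embed pυ) X) ≈ Πl (map (weight r) X) * N X
  υr-image altN uX = P.induced-image (enumPE p m) υ-gen (generator pυ r) υ-gen≋generator (embed pυ) (weight r)
    (Embedding.generator-embed pυ (λ { ≡.refl → ≡.refl }) (λ _ _ ()) r) altN (enumPE-unique p m) uX
    (All.tabulate (λ {z} _ → ∈-enumPE z))

  ιg-VanishesAt-pυ : ∀ N q → VanishesAt (pυ q) (ιg N)
  ιg-VanishesAt-pυ N q = induced-VanishesAt (enumPE p m) ι-gen (generator pι g) ι-gen≋generator
    (λ a → trans (*-congˡ (G.δ-≢ (pυ≢ a))) (zeroʳ _)) N
    where
    pυ≢ : ∀ a → pυ q ≢ embed pι a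
    pυ≢ (inj₁ _) ()
    pυ≢ (inj₂ _) ()

  υr-VanishesAt-pι : ∀ N q → VanishesAt (pι q) (υr N)
  υr-VanishesAt-pι N q = induced-VanishesAt (enumPE p m) υ-gen (generator pυ r) υ-gen≋generator
    (λ a → trans (*-congˡ (G.δ-≢ (pι≢ a))) (zeroʳ _)) N
    where
    pι≢ : ∀ a → pι q ≢ embed pυ a
    pι≢ (inj₁ _) ()
    pι≢ (inj₂ _) ()

  map-embed : ∀ pX (Q : List (Fin p)) (A : List (Fin m)) →
              map (embed pX) (map inj₁ Q ++ map inj₂ A) ≡ map pX Q ++ map ee A
  map-embed pX Q A = ≡.trans (Listₚ.map-++ (embed pX) (map inj₁ Q) (map inj₂ A))
                             (≡.cong₂ _++_ (≡.sym (Listₚ.map-∘ Q)) (≡.sym (Listₚ.map-∘ A)))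

  Πl-weight : ∀ h (Q : List (Fin p)) (A : List (Fin m)) → Πl (map (weight h) (map inj₁ Q ++ map inj₂ A)) ≈ Πl (map h A)
  Πl-weight h [] [] = refl
  Πl-weight h [] (e ∷ A) = *-congˡ (Πl-weight h [] A)
  Πl-weight h (q ∷ Q) A = trans (*-identityˡ _) (Πl-weight h Q A)

  module Coordinate {N : MV (PE p m)} (altN : Alternating N) {I V Vbar Ps : List (Fin p)} {Es : List (Fin m)}
                    (uI : Unique I) (uV : Unique V) (Vbar↭ : Vbar ↭ complP V) (Ps↭ : Ps ↭ allFin p)
                    (Es↭ : Es ↭ allFin m) where
    open NaturalCoefficients commutativeSemiring using (solve; _:=_; _:*_)

    I₁ V₁ Vbar₁ Ps₁ Es₂ : List (PE p m)
    I₁ = map inj₁ I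
    V₁ = map inj₁ V
    Vbar₁ = map inj₁ Vbar
    Ps₁ = map inj₁ Ps
    Es₂ = map inj₂ Es

    x y x′ y′ : MV (Ground3 p m)
    x = ιg N
    y = υr (dual N)
    x′ L = sgn (length (map (pυ {m = m}) V) ℕ.* length L) * x (map pι I ++ L)
    y′ R = y (map pυ V ++ R)

    term : List (Fin m) × List (Fin m) × Carrier → Carrier
    term (A , B , σ) = σ * (x′ (map ee A) * y′ (map ee B))

    H : List (Fin m) × List (Fin m) → Carrier
    H (A , B) = N (I₁ ++ map inj₂ A) * N (Vbar₁ ++ map inj₂ A) * Πl (map g A) * Πl (map r B)

    coordinate-expansion : M_ Es N (map pι I ++ map pυ V) ≈ Σl (map term (splits Es))
    coordinate-expansion = begin
      M_ Es N (map pι I ++ map pυ V)                         ≡⟨ /-eval (x ∧ y) (map ee Es) _ ⟩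
      (x ∧ y) ((map pι I ++ map pυ V) ++ map ee Es)          ≡⟨ ≡.cong (x ∧ y) (Listₚ.++-assoc (map pι I) (map pυ V) _) ⟩
      (x ∧ y) (map pι I ++ map pυ V ++ map ee Es)
        ≈⟨ ∧-prefixˡ (map pι I) (AllP.map⁺ (All.universal (υr-VanishesAt-pι (dual N)) I)) _ ⟩
      ((λ L → x (map pι I ++ L)) ∧ y) (map pυ V ++ map ee Es)
        ≈⟨ ∧-prefixʳ (map pυ V) (AllP.map⁺ (All.universal xI-VanishesAt-pυ V)) _ ⟩
      (x′ ∧ y′) (map ee Es)                                  ≡⟨ ≡.cong (Σl ∘ map wedgeTerm) (splits-map ee Es) ⟩
      Σl (map wedgeTerm (map (mapSplit ee) (splits Es)))     ≡⟨ Σl-map wedgeTerm (mapSplit ee) (splits Es) ⟩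
      Σl (map term (splits Es))                              ∎
      where
      xI-VanishesAt-pυ : ∀ q → VanishesAt (pυ q) (λ L → x (map pι I ++ L))
      xI-VanishesAt-pυ q L R = trans (reflexive (≡.cong x (≡.sym (Listₚ.++-assoc (map pι I) L _))))
                                     (ιg-VanishesAt-pυ N q (map pι I ++ L) R)
      wedgeTerm : List (Ground3 p m) × List (Ground3 p m) × Carrier → Carrier
      wedgeTerm (L , R , σ) = σ * (x′ L * y′ R)

    VVbar↭ : V ++ Vbar ↭ allFin p
    VVbar↭ = ↭.trans (↭ₚ.++⁺ˡ V Vbar↭) (FinComplement.complementIn-++-↭ (Uniqueₚ.allFin⁺ p) uV ∈-allFin)
      where module FinComplement = Complement (Data.Fin._≟_ {p})

    orientation : ε (Vbar₁ ++ V₁) * ε ((Vbar₁ ++ V₁) ++ Es₂) ≈ ε Ps₁ * ε (Ps₁ ++ Es₂)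
    orientation = begin
      ε (Vbar₁ ++ V₁) * ε ((Vbar₁ ++ V₁) ++ Es₂)
        ≡⟨ ≡.cong (λ Z → ε Z * ε (Z ++ Es₂)) (Listₚ.map-++ inj₁ Vbar V) ⟨
      ε (map inj₁ (Vbar ++ V)) * ε (map inj₁ (Vbar ++ V) ++ Es₂)
        ≈⟨ alternating-product-resp-↭ VbarV↭Ps {ε ∘ map inj₁} {λ Z → ε (map inj₁ Z ++ Es₂)}
             (Alternating-map {f = ε} inj₁ ε-alternating)
             (Alternating-map {f = λ Y → ε (Y ++ Es₂)} inj₁ (Alternating-suffix {f = ε} Es₂ ε-alternating)) ⟩
      ε Ps₁ * ε (Ps₁ ++ Es₂)                         ∎
      where
      VbarV↭Ps : Vbar ++ V ↭ Ps
      VbarV↭Ps = ↭.trans (↭ₚ.++-comm Vbar V) (↭.trans VVbar↭ (↭.↭-sym Ps↭))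

    module _ {A B σ} (sh : Shuffle Es A B σ) where
      private
        A₂ B₂ : List (PE p m)
        A₂ = map inj₂ A
        B₂ = map inj₂ B
        uAB : Unique (A ++ B)
        uAB = Unique-resp-↭ (↭.↭-sym (↭.trans (Shuffle-↭ sh) Es↭)) (Uniqueₚ.allFin⁺ m)

      x-value : x (map pι I ++ map ee A) ≈ Πl (map g A) * N (I₁ ++ A₂)
      x-value = begin
        x (map pι I ++ map ee A)                       ≡⟨ ≡.cong x (map-embed pι I A) ⟨
        x (map (embed pι) (I₁ ++ A₂))                  ≈⟨ ιg-image altN (Unique-inj₁-++-inj₂ uI (proj₁ (Unique-++⁻ A uAB))) ⟩
        Πl (map (weight g) (I₁ ++ A₂)) * N (I₁ ++ A₂)  ≈⟨ *-congʳ (Πl-weight g I A) ⟩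
        Πl (map g A) * N (I₁ ++ A₂)                    ∎

      y-value : y (map pυ V ++ map ee B) ≈ Πl (map r B) * (N (Vbar₁ ++ A₂) * ε ((Vbar₁ ++ A₂) ++ V₁ ++ B₂))
      y-value = begin
        y (map pυ V ++ map ee B)                       ≡⟨ ≡.cong y (map-embed pυ V B) ⟨
        y (map (embed pυ) (V₁ ++ B₂))
          ≈⟨ υr-image (dual-alternating N) (Unique-inj₁-++-inj₂ uV (proj₂ (Unique-++⁻ A uAB))) ⟩
        Πl (map (weight r) (V₁ ++ B₂)) * dual N (V₁ ++ B₂)
          ≈⟨ *-cong (Πl-weight r V B) (dual-complement {N} altN (complPE-partition {V = V} {Vbar} {A} {B} VVbar↭ BA↭)) ⟩
        Πl (map r B) * (N (Vbar₁ ++ A₂) * ε ((Vbar₁ ++ A₂) ++ V₁ ++ B₂)) ∎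
        where
        BA↭ : B ++ A ↭ allFin m
        BA↭ = ↭.trans (↭ₚ.++-comm B A) (↭.trans (Shuffle-↭ sh) Es↭)

      ε-value : ε ((Vbar₁ ++ A₂) ++ V₁ ++ B₂) ≈ sgn (length A ℕ.* length V) * (σ * ε ((Vbar₁ ++ V₁) ++ Es₂))
      ε-value = begin
        ε ((Vbar₁ ++ A₂) ++ V₁ ++ B₂)                                  ≡⟨ ≡.cong ε (Listₚ.++-assoc Vbar₁ A₂ _) ⟩
        ε (Vbar₁ ++ A₂ ++ V₁ ++ B₂)
          ≈⟨ swap-blocks {f = λ Z → ε (Vbar₁ ++ Z)} (Alternating-prefix {f = ε} Vbar₁ ε-alternating) A₂ V₁ B₂ ⟩
        sgn (length A₂ ℕ.* length V₁) * ε (Vbar₁ ++ V₁ ++ A₂ ++ B₂)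
          ≡⟨ ≡.cong₂ (λ k Z → sgn k * ε Z) (≡.cong₂ ℕ._*_ (Listₚ.length-map inj₂ A) (Listₚ.length-map inj₁ V))
               (≡.trans (≡.sym (Listₚ.++-assoc Vbar₁ V₁ _))
                        (≡.cong ((Vbar₁ ++ V₁) ++_) (≡.sym (Listₚ.map-++ inj₂ A B)))) ⟩
        sgn (length A ℕ.* length V) * ε ((Vbar₁ ++ V₁) ++ map inj₂ (A ++ B))
          ≈⟨ *-congˡ (Shuffle-sign sh {λ Z → ε ((Vbar₁ ++ V₁) ++ map inj₂ Z)}
               (Alternating-map {f = λ Y → ε ((Vbar₁ ++ V₁) ++ Y)} inj₂
                  (Alternating-prefix {f = ε} (Vbar₁ ++ V₁) ε-alternating))) ⟩
        sgn (length A ℕ.* length V) * (σ * ε ((Vbar₁ ++ V₁) ++ Es₂))   ∎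

      term-identity : ε (Vbar₁ ++ V₁) * ε (Ps₁ ++ Es₂) * term (A , B , σ) ≈ ε Ps₁ * H (A , B)
      term-identity = begin
        εVV * εPE * (σ * (x′ (map ee A) * y′ (map ee B)))
          ≈⟨ *-congˡ (*-congˡ (*-cong (*-cong (reflexive (≡.cong sgn |V||A|≡|A||V|)) x-value)
                                      (trans y-value (*-congˡ (*-congˡ ε-value))))) ⟩
        εVV * εPE * (σ * (k * (gA * NIA) * (rB * (NVA * (k * (σ * εVVE))))))
          ≈⟨ solve 9 (λ εVV εPE σ k gA NIA rB NVA εVVE →
                 ((εVV :* εPE) :* (σ :* ((k :* (gA :* NIA)) :* (rB :* (NVA :* (k :* (σ :* εVVE)))))))
                 := ((((εVV :* εVVE) :* εPE) :* ((σ :* σ) :* (k :* k))) :* (((NIA :* NVA) :* gA) :* rB)))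
               refl εVV εPE σ k gA NIA rB NVA εVVE ⟩
        εVV * εVVE * εPE * ((σ * σ) * (k * k)) * H (A , B)
          ≈⟨ *-congʳ (*-cong (*-congʳ orientation) (*-cong (Shuffle-sign-sq sh) (sgn-sq (length A ℕ.* length V)))) ⟩
        εP * εPE * εPE * (1# * 1#) * H (A , B)
          ≈⟨ *-congʳ (trans (*-congˡ (*-identityˡ 1#)) (*-identityʳ _)) ⟩
        εP * εPE * εPE * H (A , B)
          ≈⟨ *-congʳ (trans (*-assoc εP εPE εPE)
                            (trans (*-congˡ (ε-sq (Unique-inj₁-++-inj₂ uPs uEs))) (*-identityʳ εP))) ⟩
        εP * H (A , B)                                 ∎
        where
        εVV εPE εP εVVE k gA rB NIA NVA : Carrier
        εVV = ε (Vbar₁ ++ V₁)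
        εPE = ε (Ps₁ ++ Es₂)
        εP = ε Ps₁
        εVVE = ε ((Vbar₁ ++ V₁) ++ Es₂)
        k = sgn (length A ℕ.* length V)
        gA = Πl (map g A)
        rB = Πl (map r B)
        NIA = N (I₁ ++ A₂)
        NVA = N (Vbar₁ ++ A₂)
        |V||A|≡|A||V| : length (map pυ V) ℕ.* length (map ee A) ≡ length A ℕ.* length V
        |V||A|≡|A||V| = ≡.trans (≡.cong₂ ℕ._*_ (Listₚ.length-map pυ V) (Listₚ.length-map ee A))
                                (ℕₚ.*-comm (length V) (length A))
        uPs : Unique Ps
        uPs = Unique-resp-↭ (↭.↭-sym Ps↭) (Uniqueₚ.allFin⁺ p)
        uEs : Unique Es
        uEs = Unique-resp-↭ (↭.↭-sym Es↭) (Uniqueₚ.allFin⁺ m)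

proposition18 : ∀ {c ℓ} (F : Field c ℓ) → let open Ext F in
    (p m : ℕ) (ε : List (PE p m) → Carrier) → IsGroundOrientation ε →
    (g r : Fin m → Carrier) (N : MV (PE p m)) → IsExtensor N →
    (Ps : List (Fin p)) → Ps ↭ allFin p →
    (Es : List (Fin m)) → Es ↭ allFin m →
    (I V : List (Fin p)) → Unique I → Unique V →
    (Vbar : List (Fin p)) → Vbar ↭ complP V →
    let open Ported ε g r in
      ε (map inj₁ Vbar ++ map inj₁ V) * ε (map inj₁ Ps ++ map inj₂ Es)
        * M_ Es N (map pι I ++ map pυ V)
      ≈ ε (map inj₁ Ps)
        * Σl (map (λ AB → N (map inj₁ I ++ map inj₂ (proj₁ AB))
                          * N (map inj₁ Vbar ++ map inj₂ (proj₁ AB))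
                          * Πl (map g (proj₁ AB)) * Πl (map r (proj₂ AB)))
                  (subsetsC Es))
proposition18 F p m ε εo g r N isExtensor Ps Ps↭ Es Es↭ I V uI uV Vbar Vbar↭ = begin
  ε (Vbar₁ ++ V₁) * ε (Ps₁ ++ Es₂) * M_ Es N (map pι I ++ map pυ V)    ≈⟨ *-congˡ coordinate-expansion ⟩
  ε (Vbar₁ ++ V₁) * ε (Ps₁ ++ Es₂) * Σl (map term (splits Es))         ≈⟨ *-distribˡ-Σl _ term (splits Es) ⟩
  Σl (map (λ t → ε (Vbar₁ ++ V₁) * ε (Ps₁ ++ Es₂) * term t) (splits Es))
    ≈⟨ Σl-cong-All (All.map term-identity (splits-Shuffle Es)) ⟩
  Σl (map (λ (A , B , _) → ε Ps₁ * H (A , B)) (splits Es))             ≈⟨ *-distribˡ-Σl _ _ (splits Es) ⟨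
  ε Ps₁ * Σl (map (λ (A , B , _) → H (A , B)) (splits Es))             ≡⟨ ≡.cong (ε Ps₁ *_) (Σl-map H _ (splits Es)) ⟨
  ε Ps₁ * Σl (map H (map _ (splits Es)))                               ≡⟨ ≡.cong (λ l → ε Ps₁ * Σl (map H l)) (map-splits≡subsetsC Es) ⟩
  ε Ps₁ * Σl (map H (subsetsC Es))                                     ∎
  where
  open Ext F
  open Exterior F
  open Ported ε g r
  open PortedExtensor F ε εo g r
  open Coordinate {N} (IsExtensor⇒Alternating isExtensor) uI uV Vbar↭ Ps↭ Es↭
  open import Relation.Binary.Reasoning.Setoid setoid
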